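{- Let $n\ge 1$ and $k\ge 1$ be integers, and let $\lambda=(k)$ be the one-row partition. Then $$G_{(k)}(\underbrace{1,1,\dots,1}_{n}\mid \beta)=\binom{n+k-1}{k}\,{}_2F_1\!\left(k,\,1-n;\,k+1;\,-\beta\right).$$
   Context: For a partition $\lambda$ with at most $n$ parts, a set-valued tableau of shape $\lambda$ with entries in $[n]=\{1,\dots,n\}$ assigns to each box $(i,j)$ of the Young diagram of $\lambda$ a non-empty subset $T_{i,j}\subseteq[n]$ such that $\max T_{i,j}\le \min T_{i,j+1}$ and $\max T_{i,j}<\min T_{i+1,j}$ whenever these boxes exist. Let $\mathrm{SVT}(\lambda,n)$ be the set of such tableaux. For $T\in\mathrm{SVT}(\lambda,n)$ let $|T|=\sum_{(i,j)}|T_{i,j}|$, $\omega_m(T)$ the number of boxes whose set contains $m$, and $x^{\omega(T)}=\prod_{m=1}^n x_m^{\omega_m(T)}$. The (stable) Grothendieck polynomial is $G_\lambda(x_1,\dots,x_n\mid\beta)=\sum_{T\in\mathrm{SVT}(\lambda,n)}\beta^{|T|-|\lambda|}x^{\omega(T)}$, where $|\lambda|$ is the number of boxes of $\lambda$. The Gauss hypergeometric series is ${}_2F_1(a,b;c;z)=\sum_{m\ge0}\frac{(a)_m(b)_m}{(c)_m}\frac{z^m}{m!}$ with $(a)_m=a(a+1)\cdots(a+m-1)$, $(a)_0=1$; here it terminates, so it is a polynomial in $\beta$. -}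

module Defs where

open import Data.Bool using (Bool; true; false; T; if_then_else_)
open import Data.Nat as ℕ using (ℕ; zero; suc; _∸_; _⊔_)
import Data.Nat.Properties as ℕP
open import Data.Integer using (+_)
open import Data.Fin using (Fin)
open import Data.Fin.Subset using (Subset; inside; outside)
open import Data.Vec as Vec using (Vec; []; _∷_)
open import Data.Nat.ListAction using (sum)
open import Data.List as List using (List; []; _∷_; _++_; concatMap; filter)
open import Data.Product using (_×_; _,_)
open import Data.Unit using (⊤; tt)
open import Relation.Nullary using (Dec; yes; no)
open import Relation.Nullary.Decidable using (True)
open import Data.Rational using (ℚ; 0ℚ; 1ℚ; _+_; _*_; _-_; -_; _÷_; _/_; ≢-nonZero)
open import Data.Rational.Properties using (_≟_)

ℕtoℚ : ℕ → ℚ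
ℕtoℚ n = + n / 1

_^ℚ_ : ℚ → ℕ → ℚ
x ^ℚ zero  = 1ℚ
x ^ℚ suc m = x * (x ^ℚ m)

-- total division: p / q for q ≠ 0 (junk value 0 when q = 0;
-- only ever applied to non-zero denominators below)
_divℚ_ : ℚ → ℚ → ℚ
p divℚ q with q ≟ 0ℚ
... | yes _  = 0ℚ
... | no q≢0 = _÷_ p q {{≢-nonZero q≢0}}

poch : ℚ → ℕ → ℚ
poch a zero    = 1ℚ
poch a (suc m) = poch a m * (a + ℕtoℚ m)

factℚ : ℕ → ℚ
factℚ zero    = 1ℚ
factℚ (suc m) = factℚ m * ℕtoℚ (suc m)

sumTo : ℕ → (ℕ → ℚ) → ℚ
sumTo zero    f = f 0
sumTo (suc N) f = sumTo N f + f (suc N)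

₂F₁≤ : ℚ → ℚ → ℚ → ℚ → ℕ → ℚ
₂F₁≤ a b c z N =
  sumTo N (λ m → ((poch a m * poch b m) divℚ (poch c m)) * ((z ^ℚ m) divℚ factℚ m))

-- When b = -d for d : ℕ, every term with m > d vanishes ((b)_m = 0), so the
-- series terminates and equals its partial sum up to d.
-- 2F1(a, -d; c; z) as a terminating series:
₂F₁-term : ℚ → ℕ → ℚ → ℚ → ℚ
₂F₁-term a d c z = ₂F₁≤ a (- ℕtoℚ d) c z d

-- Subsets of [n] = {1,...,n}; position i of a 'Subset n' (i : Fin n)
-- stands for the element i+1.

allSubsets : (n : ℕ) → List (Subset n)
allSubsets zero    = [] ∷ []
allSubsets (suc n) =
  List.map (outside ∷_) (allSubsets n) ++ List.map (inside ∷_) (allSubsets n)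

card : ∀ {n} → Subset n → ℕ
card []            = 0
card (true  ∷ p)   = suc (card p)
card (false ∷ p)   = card p

isNonempty : ∀ {n} → Subset n → Bool
isNonempty []          = false
isNonempty (true ∷ p)  = true
isNonempty (false ∷ p) = isNonempty p

-- max A and min A as elements of {1..n} (meaningful for non-empty A)
maxS : ∀ {n} → Subset n → ℕ
maxS []          = 0
maxS (b ∷ p) with isNonempty p
... | true  = suc (maxS p)
... | false = if b then 1 else 0

minS : ∀ {n} → Subset n → ℕ
minS []          = 0
minS (true  ∷ p) = 1
minS (false ∷ p) = suc (minS p)

memb : ∀ {n} → ℕ → Subset n → Bool
memb m       []      = false
memb zero    (b ∷ p) = false
memb (suc zero)    (b ∷ p) = b
memb (suc (suc m)) (b ∷ p) = memb (suc m) p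

-- A partition is given by its list of row lengths λ = (λ₁, λ₂, ...).
Partition : Set
Partition = List ℕ

size : Partition → ℕ
size = sum

-- A filling of the Young diagram of λ by subsets of [n]: one vector of
-- subsets per row, of the row's length.
Filling : ℕ → Partition → Set
Filling n []      = ⊤
Filling n (r ∷ μ) = Vec (Subset n) r × Filling n μ

allVecs : {A : Set} → List A → (r : ℕ) → List (Vec A r)
allVecs xs zero    = [] ∷ []
allVecs xs (suc r) = concatMap (λ x → List.map (x ∷_) (allVecs xs r)) xs

allFillings : (n : ℕ) → (sh : Partition) → List (Filling n sh)
allFillings n []      = tt ∷ []
allFillings n (r ∷ μ) =
  concatMap (λ row → List.map (row ,_) (allFillings n μ)) (allVecs (allSubsets n) r)

and : Bool → Bool → Bool
and true  b = b
and false _ = false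

allNonempty : ∀ {n r} → Vec (Subset n) r → Bool
allNonempty []      = true
allNonempty (A ∷ v) = and (isNonempty A) (allNonempty v)

rowOK : ∀ {n r} → Vec (Subset n) r → Bool
rowOK []          = true
rowOK (A ∷ [])    = true
rowOK (A ∷ B ∷ v) = and (Dec.does (maxS A ℕ.≤? minS B)) (rowOK (B ∷ v))
  where open import Relation.Nullary using (module Dec)

colOK : ∀ {n r s} → Vec (Subset n) r → Vec (Subset n) s → Bool
colOK []      _       = true
colOK (_ ∷ _) []      = true
colOK (A ∷ u) (B ∷ v) = and (Dec.does (maxS A ℕ.<? minS B)) (colOK u v)
  where open import Relation.Nullary using (module Dec)

isSVT : ∀ {n} (sh : Partition) → Filling n sh → Bool
isSVT []            tt                 = true
isSVT (r ∷ [])      (row , tt)         = and (allNonempty row) (rowOK row)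
isSVT (r ∷ s ∷ μ)   (row , (row′ , F)) =
  and (allNonempty row) (and (rowOK row)
    (and (colOK row row′) (isSVT (s ∷ μ) (row′ , F))))

SVT : (sh : Partition) → (n : ℕ) → List (Filling n sh)
SVT sh n = filter (λ F → T? (isSVT sh F)) (allFillings n sh)
  where
  open import Data.Bool.Properties using () renaming (T? to T?)

totalSize : ∀ {n} (sh : Partition) → Filling n sh → ℕ
totalSize []      tt        = 0
totalSize (r ∷ μ) (row , F) = Vec.sum (Vec.map card row) ℕ.+ totalSize μ F

omega : ∀ {n} (sh : Partition) → Filling n sh → ℕ → ℕ
omega []      tt        m = 0
omega (r ∷ μ) (row , F) m =
  Vec.sum (Vec.map (λ A → if memb m A then 1 else 0) row) ℕ.+ omega μ F m

monomial : ∀ {n} (sh : Partition) → (Fin n → ℚ) → Filling n sh → ℚ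
monomial {n} sh x F =
  Vec.foldr _ _*_ 1ℚ
    (Vec.tabulate (λ i → x i ^ℚ omega sh F (suc (Data.Fin.toℕ i))))
  where import Data.Fin

G : (sh : Partition) (n : ℕ) → (Fin n → ℚ) → ℚ → ℚ
G sh n x β =
  List.foldr _+_ 0ℚ
    (List.map (λ F → (β ^ℚ (totalSize sh F ∸ size sh)) * monomial sh x F)
              (SVT sh n))

{-# OPTIONS --safe #-}
-- Write L(n,k) = G_(k)(1,…,1 | β) with n ones. Classifying the row tableaux over [n+1] by the letter 1
-- (it does not occur; the first box is {1}; or it is the minimum of a larger first box) gives
--   L(n+1,k+1) = L(n,k+1) + L(n+1,k) + β L(n,k+1),   L(n,0) = 1,   L(0,k+1) = 0.
-- By Pascal's rule in both binomials, Σ_m C(n+k-1,k+m) C(k+m-1,m) β^m obeys the same recursion, and its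
-- coefficients have consecutive ratios (k+m)(n-1-m) / ((k+m+1)(m+1)), those of C(n+k-1,k) ₂F₁(k,1-n;k+1;-β).
module Submission where

open import Defs

-- Rational arithmetic is opened only inside this module, so that `_+_` in the statement below is on ℕ.
module _ where
  open import Data.Bool using (Bool; true; false; if_then_else_)
  open import Data.Nat as ℕ using (ℕ; zero; suc; _∸_; _≤ᵇ_; _≤_; z≤n; s≤s; NonZero; _!)
  import Data.Nat.Properties as ℕ
  open import Data.Nat.Combinatorics using (_C_; nCk+nC[k+1]≡[n+1]C[k+1]; k>n⇒nCk≡0; nC1≡n)
  open import Data.Nat.Combinatorics.Base using (_P′_)
  import Data.Integer as ℤ
  import Data.Integer.Properties as ℤ
  import Data.Nat.Coprimality as Coprime
  open import Data.Rational using (ℚ; mkℚ; 0ℚ; 1ℚ; _+_; _*_; -_; _/_; 1/_; ≢-nonZero)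
  open import Data.Rational.Properties
  open import Data.Rational.Solver using (module +-*-Solver)
  open import Data.Nat.Solver using () renaming (module +-*-Solver to NatSolver)
  open import Algebra.Bundles using (CommutativeMonoid)
  import Algebra.Properties.CommutativeSemigroup (CommutativeMonoid.commutativeSemigroup +-0-commutativeMonoid) as ℚ+
  import Algebra.Properties.CommutativeSemigroup (CommutativeMonoid.commutativeSemigroup *-1-commutativeMonoid) as ℚ*
  import Algebra.Properties.CommutativeSemigroup ℕ.+-commutativeSemigroup as ℕ+
  open import Data.Fin as Fin using (Fin)
  open import Data.Fin.Subset using (Subset; inside; outside)
  open import Data.Vec as Vec using (Vec; []; _∷_)
  open import Data.List as List using (List; []; _∷_; _++_; concatMap; filter)
  open import Data.Product using (∃-syntax; _,_)
  open import Data.Unit using (tt)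
  open import Data.Empty using (⊥-elim)
  open import Data.Bool.Properties using (T?)
  open import Relation.Nullary using (yes; no)
  open import Relation.Binary.PropositionalEquality
  open ≡-Reasoning

  ℕtoℚ≡mkℚ : ∀ n → ℕtoℚ n ≡ mkℚ (ℤ.+ n) 0 (Coprime.sym (Coprime.1-coprimeTo n))
  ℕtoℚ≡mkℚ n = normalize-coprime (Coprime.sym (Coprime.1-coprimeTo n))

  ℕtoℚ-suc : ∀ n → ℕtoℚ (suc n) ≡ 1ℚ + ℕtoℚ n
  ℕtoℚ-suc n = sym (begin
    1ℚ + ℕtoℚ n
      ≡⟨ cong (1ℚ +_) (ℕtoℚ≡mkℚ n) ⟩
    (ℤ.+ 1 ℤ.* ℤ.+ 1 ℤ.+ ℤ.+ n ℤ.* ℤ.+ 1) / 1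
      ≡⟨ /-cong (cong (λ z → ℤ.+ 1 ℤ.+ z) (ℤ.*-identityʳ (ℤ.+ n))) refl ⟩
    ℕtoℚ (suc n) ∎)

  ℕtoℚ-+ : ∀ a b → ℕtoℚ (a ℕ.+ b) ≡ ℕtoℚ a + ℕtoℚ b
  ℕtoℚ-+ zero    b = sym (+-identityˡ (ℕtoℚ b))
  ℕtoℚ-+ (suc a) b = begin
    ℕtoℚ (suc (a ℕ.+ b))   ≡⟨ ℕtoℚ-suc (a ℕ.+ b) ⟩
    1ℚ + ℕtoℚ (a ℕ.+ b)    ≡⟨ cong (1ℚ +_) (ℕtoℚ-+ a b) ⟩
    1ℚ + (ℕtoℚ a + ℕtoℚ b) ≡⟨ +-assoc 1ℚ (ℕtoℚ a) (ℕtoℚ b) ⟨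
    1ℚ + ℕtoℚ a + ℕtoℚ b   ≡⟨ cong (_+ ℕtoℚ b) (ℕtoℚ-suc a) ⟨
    ℕtoℚ (suc a) + ℕtoℚ b  ∎

  ℕtoℚ-* : ∀ a b → ℕtoℚ (a ℕ.* b) ≡ ℕtoℚ a * ℕtoℚ b
  ℕtoℚ-* zero    b = sym (*-zeroˡ (ℕtoℚ b))
  ℕtoℚ-* (suc a) b = begin
    ℕtoℚ (b ℕ.+ a ℕ.* b)           ≡⟨ ℕtoℚ-+ b (a ℕ.* b) ⟩
    ℕtoℚ b + ℕtoℚ (a ℕ.* b)        ≡⟨ cong₂ _+_ (sym (*-identityˡ (ℕtoℚ b))) (ℕtoℚ-* a b) ⟩
    1ℚ * ℕtoℚ b + ℕtoℚ a * ℕtoℚ b  ≡⟨ *-distribʳ-+ (ℕtoℚ b) 1ℚ (ℕtoℚ a) ⟨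
    (1ℚ + ℕtoℚ a) * ℕtoℚ b         ≡⟨ cong (_* ℕtoℚ b) (ℕtoℚ-suc a) ⟨
    ℕtoℚ (suc a) * ℕtoℚ b          ∎

  ℕtoℚ-+-* : ∀ a b x → ℕtoℚ a * x + ℕtoℚ b * x ≡ ℕtoℚ (a ℕ.+ b) * x
  ℕtoℚ-+-* a b x = trans (sym (*-distribʳ-+ x (ℕtoℚ a) (ℕtoℚ b))) (cong (_* x) (sym (ℕtoℚ-+ a b)))

  ℕtoℚ-*³ : ∀ a b c → ℕtoℚ (a ℕ.* b ℕ.* c) ≡ ℕtoℚ a * ℕtoℚ b * ℕtoℚ c
  ℕtoℚ-*³ a b c = trans (ℕtoℚ-* (a ℕ.* b) c) (cong (_* ℕtoℚ c) (ℕtoℚ-* a b))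

  c≡0⇒ℕtoℚ[c]*x≡0 : ∀ {c} → c ≡ 0 → ∀ x → ℕtoℚ c * x ≡ 0ℚ
  c≡0⇒ℕtoℚ[c]*x≡0 refl x = *-zeroˡ x

  ℕtoℚ-≢0 : ∀ n .{{_ : NonZero n}} → ℕtoℚ n ≢ 0ℚ
  ℕtoℚ-≢0 (suc n) eq with cong ℚ.numerator (trans (sym (ℕtoℚ≡mkℚ (suc n))) eq)
  ... | ()

  ^ℚ-+ : ∀ x a b → x ^ℚ (a ℕ.+ b) ≡ x ^ℚ a * x ^ℚ b
  ^ℚ-+ x zero    b = sym (*-identityˡ (x ^ℚ b))
  ^ℚ-+ x (suc a) b = trans (cong (x *_) (^ℚ-+ x a b)) (sym (*-assoc x (x ^ℚ a) (x ^ℚ b)))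

  1^ℚ : ∀ a → 1ℚ ^ℚ a ≡ 1ℚ
  1^ℚ zero    = refl
  1^ℚ (suc a) = trans (*-identityˡ (1ℚ ^ℚ a)) (1^ℚ a)

  sign : ℕ → ℚ
  sign m = (- 1ℚ) ^ℚ m

  neg-^ℚ : ∀ x m → (- x) ^ℚ m ≡ sign m * x ^ℚ m
  neg-^ℚ x zero    = sym (*-identityˡ 1ℚ)
  neg-^ℚ x (suc m) = begin
    - x * (- x) ^ℚ m          ≡⟨ cong (- x *_) (neg-^ℚ x m) ⟩
    - x * (sign m * x ^ℚ m)   ≡⟨ solve 3 (λ x s p → :- x :* (s :* p) := (:- con 1ℚ :* s) :* (x :* p)) refl
                                         x (sign m) (x ^ℚ m) ⟩
    sign (suc m) * x ^ℚ suc m ∎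
    where open +-*-Solver

  sign-square : ∀ m → sign m * sign m ≡ 1ℚ
  sign-square zero    = refl
  sign-square (suc m) = trans (solve 1 (λ s → (:- con 1ℚ :* s) :* (:- con 1ℚ :* s) := s :* s) refl (sign m)) (sign-square m)
    where open +-*-Solver

  divℚ-*-cancel : ∀ p q → q ≢ 0ℚ → (p divℚ q) * q ≡ p
  divℚ-*-cancel p q q≢0 with q ≟ 0ℚ
  ... | yes q≡0 = ⊥-elim (q≢0 q≡0)
  ... | no  _   = begin
    p * 1/ q * q   ≡⟨ *-assoc p (1/ q) q ⟩
    p * (1/ q * q) ≡⟨ cong (p *_) (*-inverseˡ q) ⟩
    p * 1ℚ         ≡⟨ *-identityʳ p ⟩
    p              ∎
    where instance _ = ≢-nonZero q≢0

  *-cancelʳ : ∀ x y {z} → z ≢ 0ℚ → x * z ≡ y * z → x ≡ y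
  *-cancelʳ x y {z} z≢0 xz≡yz = begin
    x                ≡⟨ *-identityʳ x ⟨
    x * 1ℚ           ≡⟨ cong (x *_) (*-inverseʳ z) ⟨
    x * (z * 1/ z)   ≡⟨ *-assoc x z (1/ z) ⟨
    x * z * 1/ z     ≡⟨ cong (_* 1/ z) xz≡yz ⟩
    y * z * 1/ z     ≡⟨ *-assoc y z (1/ z) ⟩
    y * (z * 1/ z)   ≡⟨ cong (y *_) (*-inverseʳ z) ⟩
    y * 1ℚ           ≡⟨ *-identityʳ y ⟩
    y                ∎
    where instance _ = ≢-nonZero z≢0

  divℚ-cross-multiply : ∀ c a b a′ b′ x → b ≢ 0ℚ → b′ ≢ 0ℚ →
    c * a * a′ ≡ x * b * b′ → c * ((a divℚ b) * (a′ divℚ b′)) ≡ x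
  divℚ-cross-multiply c a b a′ b′ x b≢0 b′≢0 eq = *-cancelʳ _ x b≢0 (*-cancelʳ _ (x * b) b′≢0 (begin
    c * ((a divℚ b) * (a′ divℚ b′)) * b * b′
      ≡⟨ solve 5 (λ c q q′ b b′ → c :* (q :* q′) :* b :* b′ := c :* (q :* b) :* (q′ :* b′)) refl
           c (a divℚ b) (a′ divℚ b′) b b′ ⟩
    c * ((a divℚ b) * b) * ((a′ divℚ b′) * b′)
      ≡⟨ cong₂ (λ p p′ → c * p * p′) (divℚ-*-cancel a b b≢0) (divℚ-*-cancel a′ b′ b′≢0) ⟩
    c * a * a′
      ≡⟨ eq ⟩
    x * b * b′ ∎))
    where open +-*-Solver

  rising : ℕ → ℕ → ℕ
  rising a zero    = 1
  rising a (suc m) = rising a m ℕ.* (a ℕ.+ m)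

  rising-nonZero : ∀ a m → NonZero (rising (suc a) m)
  rising-nonZero a zero    = _
  rising-nonZero a (suc m) = ℕ.m*n≢0 (rising (suc a) m) (suc a ℕ.+ m) {{rising-nonZero a m}}

  poch-ℕtoℚ : ∀ a m → poch (ℕtoℚ a) m ≡ ℕtoℚ (rising a m)
  poch-ℕtoℚ a zero    = refl
  poch-ℕtoℚ a (suc m) = begin
    poch (ℕtoℚ a) m * (ℕtoℚ a + ℕtoℚ m)     ≡⟨ cong₂ _*_ (poch-ℕtoℚ a m) (sym (ℕtoℚ-+ a m)) ⟩
    ℕtoℚ (rising a m) * ℕtoℚ (a ℕ.+ m)      ≡⟨ ℕtoℚ-* (rising a m) (a ℕ.+ m) ⟨
    ℕtoℚ (rising a (suc m))                 ∎

  poch-neg : ∀ d m → m ≤ d → poch (- ℕtoℚ d) m ≡ sign m * ℕtoℚ (d P′ m)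
  poch-neg d zero    _   = refl
  poch-neg d (suc m) m<d = begin
    poch (- ℕtoℚ d) m * (- ℕtoℚ d + ℕtoℚ m)
      ≡⟨ cong₂ (λ p x → p * (- x + ℕtoℚ m)) (poch-neg d m m≤d) (cong ℕtoℚ (sym (ℕ.m∸n+n≡m m≤d))) ⟩
    sign m * ℕtoℚ (d P′ m) * (- ℕtoℚ (d ∸ m ℕ.+ m) + ℕtoℚ m)
      ≡⟨ cong (λ x → sign m * ℕtoℚ (d P′ m) * (- x + ℕtoℚ m)) (ℕtoℚ-+ (d ∸ m) m) ⟩
    sign m * ℕtoℚ (d P′ m) * (- (ℕtoℚ (d ∸ m) + ℕtoℚ m) + ℕtoℚ m)
      ≡⟨ solve 4 (λ s p x y → s :* p :* (:- (x :+ y) :+ y) := (:- con 1ℚ :* s) :* (x :* p)) refl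
           (sign m) (ℕtoℚ (d P′ m)) (ℕtoℚ (d ∸ m)) (ℕtoℚ m) ⟩
    sign (suc m) * (ℕtoℚ (d ∸ m) * ℕtoℚ (d P′ m))
      ≡⟨ cong (sign (suc m) *_) (ℕtoℚ-* (d ∸ m) (d P′ m)) ⟨
    sign (suc m) * ℕtoℚ (d P′ suc m) ∎
    where
    open +-*-Solver
    m≤d : m ≤ d
    m≤d = ℕ.<⇒≤ m<d

  factℚ-ℕtoℚ : ∀ m → factℚ m ≡ ℕtoℚ (m !)
  factℚ-ℕtoℚ zero    = refl
  factℚ-ℕtoℚ (suc m) = begin
    factℚ m * ℕtoℚ (suc m)     ≡⟨ cong (_* ℕtoℚ (suc m)) (factℚ-ℕtoℚ m) ⟩
    ℕtoℚ (m !) * ℕtoℚ (suc m)  ≡⟨ *-comm (ℕtoℚ (m !)) (ℕtoℚ (suc m)) ⟩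
    ℕtoℚ (suc m) * ℕtoℚ (m !)  ≡⟨ ℕtoℚ-* (suc m) (m !) ⟨
    ℕtoℚ (suc m !)             ∎

  ₂F₁-summand : ℚ → ℚ → ℚ → ℚ → ℕ → ℚ
  ₂F₁-summand a b c z m = ((poch a m * poch b m) divℚ poch c m) * ((z ^ℚ m) divℚ factℚ m)

  [n+1]C[k+1]≡nCk+nC[k+1] : ∀ n k → suc n C suc k ≡ n C k ℕ.+ n C suc k
  [n+1]C[k+1]≡nCk+nC[k+1] n k = sym (nCk+nC[k+1]≡[n+1]C[k+1] n k)

  [n+1]C[k+1]*[k+1]≡nCk*[n+1] : ∀ n k → (suc n C suc k) ℕ.* suc k ≡ (n C k) ℕ.* suc n
  [n+1]C[k+1]*[k+1]≡nCk*[n+1] zero    zero    = refl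
  [n+1]C[k+1]*[k+1]≡nCk*[n+1] zero    (suc k) = refl
  [n+1]C[k+1]*[k+1]≡nCk*[n+1] (suc n) zero    = begin
    (suc (suc n) C 1) ℕ.* 1      ≡⟨ ℕ.*-identityʳ _ ⟩
    suc (suc n) C 1              ≡⟨ nC1≡n (suc (suc n)) ⟩
    suc (suc n)                  ≡⟨ ℕ.*-identityˡ (suc (suc n)) ⟨
    (suc n C 0) ℕ.* suc (suc n)  ∎
  [n+1]C[k+1]*[k+1]≡nCk*[n+1] (suc n) (suc k) = begin
    (suc (suc n) C suc (suc k)) ℕ.* suc (suc k)
      ≡⟨ cong (ℕ._* suc (suc k)) ([n+1]C[k+1]≡nCk+nC[k+1] (suc n) (suc k)) ⟩
    (x ℕ.+ y) ℕ.* suc (suc k)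
      ≡⟨ solve 3 (λ x y k → (x :+ y) :* (con 2 :+ k) := x :* (con 1 :+ k) :+ x :+ y :* (con 2 :+ k)) refl x y k ⟩
    x ℕ.* suc k ℕ.+ x ℕ.+ y ℕ.* suc (suc k)
      ≡⟨ cong₂ (λ p q → p ℕ.+ x ℕ.+ q) ([n+1]C[k+1]*[k+1]≡nCk*[n+1] n k) ([n+1]C[k+1]*[k+1]≡nCk*[n+1] n (suc k)) ⟩
    u ℕ.* suc n ℕ.+ x ℕ.+ v ℕ.* suc n
      ≡⟨ cong (λ p → u ℕ.* suc n ℕ.+ p ℕ.+ v ℕ.* suc n) ([n+1]C[k+1]≡nCk+nC[k+1] n k) ⟩
    u ℕ.* suc n ℕ.+ (u ℕ.+ v) ℕ.+ v ℕ.* suc n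
      ≡⟨ solve 3 (λ u v n → u :* (con 1 :+ n) :+ (u :+ v) :+ v :* (con 1 :+ n) := (u :+ v) :* (con 2 :+ n)) refl u v n ⟩
    (u ℕ.+ v) ℕ.* suc (suc n)
      ≡⟨ cong (ℕ._* suc (suc n)) ([n+1]C[k+1]≡nCk+nC[k+1] n k) ⟨
    (suc n C suc k) ℕ.* suc (suc n) ∎
    where
    open NatSolver
    x y u v : ℕ
    x = suc n C suc k
    y = suc n C suc (suc k)
    u = n C k
    v = n C suc k

  nC[k+1]*[k+1]≡nCk*[n∸k] : ∀ n k → (n C suc k) ℕ.* suc k ≡ (n C k) ℕ.* (n ∸ k)
  nC[k+1]*[k+1]≡nCk*[n∸k] zero    k       = begin
    0                    ≡⟨ ℕ.*-zeroʳ (0 C k) ⟨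
    (0 C k) ℕ.* 0        ≡⟨ cong ((0 C k) ℕ.*_) (ℕ.0∸n≡0 k) ⟨
    (0 C k) ℕ.* (0 ∸ k)  ∎
  nC[k+1]*[k+1]≡nCk*[n∸k] (suc n) zero    = begin
    (suc n C 1) ℕ.* 1      ≡⟨ ℕ.*-identityʳ (suc n C 1) ⟩
    suc n C 1              ≡⟨ nC1≡n (suc n) ⟩
    suc n                  ≡⟨ ℕ.*-identityˡ (suc n) ⟨
    (suc n C 0) ℕ.* suc n  ∎
  nC[k+1]*[k+1]≡nCk*[n∸k] (suc n) (suc k) = begin
    (suc n C suc (suc k)) ℕ.* suc (suc k)
      ≡⟨ cong (ℕ._* suc (suc k)) ([n+1]C[k+1]≡nCk+nC[k+1] n (suc k)) ⟩
    (x ℕ.+ n C suc (suc k)) ℕ.* suc (suc k)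
      ≡⟨ ℕ.*-distribʳ-+ (suc (suc k)) x (n C suc (suc k)) ⟩
    x ℕ.* suc (suc k) ℕ.+ (n C suc (suc k)) ℕ.* suc (suc k)
      ≡⟨ cong (x ℕ.* suc (suc k) ℕ.+_) (nC[k+1]*[k+1]≡nCk*[n∸k] n (suc k)) ⟩
    x ℕ.* suc (suc k) ℕ.+ x ℕ.* (n ∸ suc k)
      ≡⟨ redistribute ⟩
    x ℕ.* suc k ℕ.+ x ℕ.* (n ∸ k)
      ≡⟨ cong (ℕ._+ x ℕ.* (n ∸ k)) (nC[k+1]*[k+1]≡nCk*[n∸k] n k) ⟩
    (n C k) ℕ.* (n ∸ k) ℕ.+ x ℕ.* (n ∸ k)
      ≡⟨ ℕ.*-distribʳ-+ (n ∸ k) (n C k) x ⟨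
    (n C k ℕ.+ x) ℕ.* (n ∸ k)
      ≡⟨ cong (ℕ._* (n ∸ k)) ([n+1]C[k+1]≡nCk+nC[k+1] n k) ⟨
    (suc n C suc k) ℕ.* (suc n ∸ suc k) ∎
    where
    open NatSolver
    x : ℕ
    x = n C suc k
    -- n ∸ k = 1 + (n ∸ suc k) when k < n; otherwise x = 0.
    redistribute : x ℕ.* suc (suc k) ℕ.+ x ℕ.* (n ∸ suc k) ≡ x ℕ.* suc k ℕ.+ x ℕ.* (n ∸ k)
    redistribute with k ℕ.<? n
    ... | yes k<n rewrite ℕ.+-∸-assoc 1 k<n =
      solve 3 (λ x k r → x :* (con 2 :+ k) :+ x :* r := x :* (con 1 :+ k) :+ x :* (con 1 :+ r)) refl x k (n ∸ suc k)
    ... | no  k≮n rewrite k>n⇒nCk≡0 (s≤s (ℕ.≮⇒≥ k≮n)) = refl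

  ∑ : {A : Set} → List A → (A → ℚ) → ℚ
  ∑ xs f = List.foldr _+_ 0ℚ (List.map f xs)

  syntax ∑ xs (λ x → e) = ∑[ x ∈ xs ] e

  private variable A B : Set

  ∑-cong : ∀ (xs : List A) {f g : A → ℚ} → (∀ x → f x ≡ g x) → ∑ xs f ≡ ∑ xs g
  ∑-cong []       f≗g = refl
  ∑-cong (x ∷ xs) f≗g = cong₂ _+_ (f≗g x) (∑-cong xs f≗g)

  ∑-++ : ∀ (xs ys : List A) f → ∑ (xs ++ ys) f ≡ ∑ xs f + ∑ ys f
  ∑-++ []       ys f = sym (+-identityˡ (∑ ys f))
  ∑-++ (x ∷ xs) ys f = trans (cong (f x +_) (∑-++ xs ys f)) (sym (+-assoc (f x) (∑ xs f) (∑ ys f)))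

  ∑-map : ∀ (g : A → B) xs (f : B → ℚ) → ∑ (List.map g xs) f ≡ ∑[ x ∈ xs ] f (g x)
  ∑-map g []       f = refl
  ∑-map g (x ∷ xs) f = cong (f (g x) +_) (∑-map g xs f)

  ∑-concatMap : ∀ (g : A → List B) xs (f : B → ℚ) →
                ∑ (concatMap g xs) f ≡ ∑[ x ∈ xs ] ∑ (g x) f
  ∑-concatMap g []       f = refl
  ∑-concatMap g (x ∷ xs) f =
    trans (∑-++ (g x) (concatMap g xs) f) (cong (∑ (g x) f +_) (∑-concatMap g xs f))

  ∑-filter : ∀ (p : A → Bool) xs f →
             ∑ (filter (λ x → T? (p x)) xs) f ≡ ∑[ x ∈ xs ] (if p x then f x else 0ℚ)
  ∑-filter p []       f = refl
  ∑-filter p (x ∷ xs) f with p x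
  ... | true  = cong (f x +_) (∑-filter p xs f)
  ... | false = trans (∑-filter p xs f) (sym (+-identityˡ _))

  ∑-+ : ∀ xs (f g : A → ℚ) → ∑[ x ∈ xs ] (f x + g x) ≡ ∑ xs f + ∑ xs g
  ∑-+ []       f g = refl
  ∑-+ (x ∷ xs) f g = trans (cong (f x + g x +_) (∑-+ xs f g)) (ℚ+.interchange (f x) (g x) (∑ xs f) (∑ xs g))

  ∑-*ˡ : ∀ xs c (f : A → ℚ) → ∑[ x ∈ xs ] (c * f x) ≡ c * ∑ xs f
  ∑-*ˡ []       c f = sym (*-zeroʳ c)
  ∑-*ˡ (x ∷ xs) c f = trans (cong (c * f x +_) (∑-*ˡ xs c f)) (sym (*-distribˡ-+ c (f x) (∑ xs f)))

  ∑-0 : ∀ (xs : List A) → ∑[ x ∈ xs ] 0ℚ ≡ 0ℚ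
  ∑-0 []       = refl
  ∑-0 (x ∷ xs) = trans (+-identityˡ _) (∑-0 xs)

  sumTo-cong : ∀ N {f g : ℕ → ℚ} → (∀ m → m ≤ N → f m ≡ g m) → sumTo N f ≡ sumTo N g
  sumTo-cong zero    f≗g = f≗g 0 z≤n
  sumTo-cong (suc N) f≗g =
    cong₂ _+_ (sumTo-cong N (λ m m≤N → f≗g m (ℕ.m≤n⇒m≤1+n m≤N))) (f≗g (suc N) ℕ.≤-refl)

  sumTo-+ : ∀ N (f g : ℕ → ℚ) → sumTo N (λ m → f m + g m) ≡ sumTo N f + sumTo N g
  sumTo-+ zero    f g = refl
  sumTo-+ (suc N) f g =
    trans (cong (_+ (f (suc N) + g (suc N))) (sumTo-+ N f g)) (ℚ+.interchange (sumTo N f) (sumTo N g) (f (suc N)) (g (suc N)))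

  sumTo-*ˡ : ∀ N c (f : ℕ → ℚ) → sumTo N (λ m → c * f m) ≡ c * sumTo N f
  sumTo-*ˡ zero    c f = refl
  sumTo-*ˡ (suc N) c f = trans (cong (_+ c * f (suc N)) (sumTo-*ˡ N c f)) (sym (*-distribˡ-+ c (sumTo N f) (f (suc N))))

  sumTo-suc : ∀ N (f : ℕ → ℚ) → sumTo (suc N) f ≡ f 0 + sumTo N (λ m → f (suc m))
  sumTo-suc zero    f = refl
  sumTo-suc (suc N) f = trans (cong (_+ f (suc (suc N))) (sumTo-suc N f)) (+-assoc (f 0) _ _)

  sumTo-concentrated : ∀ N (f : ℕ → ℚ) → (∀ m → f (suc m) ≡ 0ℚ) → sumTo N f ≡ f 0
  sumTo-concentrated zero    f f0 = refl
  sumTo-concentrated (suc N) f f0 = trans (cong₂ _+_ (sumTo-concentrated N f f0) (f0 N)) (+-identityʳ (f 0))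

  card-nonempty : ∀ {n} (A : Subset n) → isNonempty A ≡ true → card A ≡ suc (card A ∸ 1)
  card-nonempty (true  ∷ A) _  = refl
  card-nonempty (false ∷ A) ne = card-nonempty A ne

  card-empty : ∀ {n} (A : Subset n) → isNonempty A ≡ false → card A ≡ 0
  card-empty []          _  = refl
  card-empty (false ∷ A) ne = card-empty A ne

  maxS-nonempty : ∀ {n} (A : Subset n) → isNonempty A ≡ true → ∃[ x ] maxS A ≡ suc x
  maxS-nonempty (true ∷ A) _ with isNonempty A
  ... | true  = maxS A , refl
  ... | false = 0 , refl
  maxS-nonempty (false ∷ A) ne with isNonempty A
  maxS-nonempty (false ∷ A) _  | true  = maxS A , refl
  maxS-nonempty (false ∷ A) () | false

  ∑-empty : ∀ n c → ∑[ A ∈ allSubsets n ] (if isNonempty A then 0ℚ else c) ≡ c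
  ∑-empty zero    c = +-identityʳ c
  ∑-empty (suc n) c = begin
    ∑ (List.map (outside ∷_) S ++ List.map (inside ∷_) S) f
      ≡⟨ ∑-++ (List.map (outside ∷_) S) (List.map (inside ∷_) S) f ⟩
    ∑ (List.map (outside ∷_) S) f + ∑ (List.map (inside ∷_) S) f
      ≡⟨ cong₂ _+_ (∑-map (outside ∷_) S f) (∑-map (inside ∷_) S f) ⟩
    ∑[ A ∈ S ] f (outside ∷ A) + ∑[ A ∈ S ] 0ℚ
      ≡⟨ cong₂ _+_ (∑-empty n c) (∑-0 S) ⟩
    c + 0ℚ
      ≡⟨ +-identityʳ c ⟩
    c ∎
    where
    S : List (Subset n)
    S = allSubsets n
    f : Subset (suc n) → ℚ
    f A = if isNonempty A then 0ℚ else c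

  and-swap : ∀ a b c → and a (and b c) ≡ and b (and a c)
  and-swap false false c = refl
  and-swap false true  c = refl
  and-swap true  b     c = refl

  firstMin≥ : ∀ {n k} → ℕ → Vec (Subset n) k → Bool
  firstMin≥ m []      = true
  firstMin≥ m (A ∷ v) = m ≤ᵇ minS A

  validFrom : ∀ {n k} → ℕ → Vec (Subset n) k → Bool
  validFrom m []      = true
  validFrom m (A ∷ v) = and (and (isNonempty A) (m ≤ᵇ minS A)) (validFrom (maxS A) v)

  excess : ∀ {n k} → Vec (Subset n) k → ℕ
  excess v = Vec.sum (Vec.map (λ A → card A ∸ 1) v)

  rowOK-∷ : ∀ {n k} (A : Subset n) (v : Vec (Subset n) k) → rowOK (A ∷ v) ≡ and (firstMin≥ (maxS A) v) (rowOK v)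
  rowOK-∷ A []      = refl
  rowOK-∷ A (B ∷ v) = refl

  validFrom≡firstMin≥∧isSVT : ∀ {n k} m (v : Vec (Subset n) k) →
                              validFrom m v ≡ and (firstMin≥ m v) (isSVT (k ∷ []) (v , tt))
  validFrom≡firstMin≥∧isSVT m []      = refl
  validFrom≡firstMin≥∧isSVT m (A ∷ v) rewrite validFrom≡firstMin≥∧isSVT (maxS A) v | rowOK-∷ A v
    with isNonempty A | m ≤ᵇ minS A
  ... | false | false = refl
  ... | false | true  = refl
  ... | true  | false = refl
  ... | true  | true  = and-swap (firstMin≥ (maxS A) v) (allNonempty v) (rowOK v)

  validFrom0≡isSVT : ∀ {n k} (v : Vec (Subset n) k) → validFrom 0 v ≡ isSVT (k ∷ []) (v , tt)
  validFrom0≡isSVT []      = refl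
  validFrom0≡isSVT (A ∷ v) = validFrom≡firstMin≥∧isSVT 0 (A ∷ v)

  sum-card≡k+excess : ∀ {n k} (v : Vec (Subset n) k) → allNonempty v ≡ true → Vec.sum (Vec.map card v) ≡ k ℕ.+ excess v
  sum-card≡k+excess []      _  = refl
  sum-card≡k+excess {k = suc k} (A ∷ v) ne with isNonempty A in neA
  ... | true = begin
    card A ℕ.+ Vec.sum (Vec.map card v)              ≡⟨ cong₂ ℕ._+_ (card-nonempty A neA) (sum-card≡k+excess v ne) ⟩
    suc (card A ∸ 1 ℕ.+ (k ℕ.+ excess v))            ≡⟨ cong suc (ℕ+.x∙yz≈y∙xz (card A ∸ 1) k (excess v)) ⟩
    suc (k ℕ.+ (card A ∸ 1 ℕ.+ excess v))            ∎

  monomial-ones : ∀ {n} sh (F : Filling n sh) → monomial sh (λ _ → 1ℚ) F ≡ 1ℚ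
  monomial-ones {n} sh F = product-ones n (λ i → omega sh F (suc (Fin.toℕ i)))
    where
    product-ones : ∀ n (e : Fin n → ℕ) → Vec.foldr _ _*_ 1ℚ (Vec.tabulate (λ i → 1ℚ ^ℚ e i)) ≡ 1ℚ
    product-ones zero    e = refl
    product-ones (suc n) e = trans (cong₂ _*_ (1^ℚ (e Fin.zero)) (product-ones n (λ i → e (Fin.suc i)))) (*-identityˡ 1ℚ)

  ≤ᵇ-suc : ∀ m x → (m ≤ᵇ suc x) ≡ (m ∸ 1 ≤ᵇ x)
  ≤ᵇ-suc zero          x = refl
  ≤ᵇ-suc (suc zero)    x = refl
  ≤ᵇ-suc (suc (suc m)) x = refl

  module RowSums (β : ℚ) where

    boxWeight : ℕ → (ℕ → ℚ) → ∀ {n} → Subset n → ℚ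
    boxWeight m φ A = if and (isNonempty A) (m ≤ᵇ minS A) then β ^ℚ (card A ∸ 1) * φ (maxS A) else 0ℚ

    -- The bound m is the maximum of the preceding box, so that a row is weighed box by box.
    rowWeight : ∀ {n k} → ℕ → Vec (Subset n) k → ℚ
    rowWeight m []      = 1ℚ
    rowWeight m (A ∷ v) = boxWeight m (λ m′ → rowWeight m′ v) A

    rowWeight≡if-validFrom : ∀ {n k} m (v : Vec (Subset n) k) →
                             rowWeight m v ≡ (if validFrom m v then β ^ℚ excess v else 0ℚ)
    rowWeight≡if-validFrom m []      = refl
    rowWeight≡if-validFrom m (A ∷ v) with isNonempty A | m ≤ᵇ minS A
    ... | false | _     = refl
    ... | true  | false = refl
    ... | true  | true  rewrite rowWeight≡if-validFrom (maxS A) v with validFrom (maxS A) v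
    ...   | true  = sym (^ℚ-+ β (card A ∸ 1) (excess v))
    ...   | false = *-zeroʳ (β ^ℚ (card A ∸ 1))

    rowSum : ℕ → ℕ → ℕ → ℚ
    rowSum n k m = ∑[ v ∈ allVecs (allSubsets n) k ] rowWeight m v

    G≡rowSum : ∀ n k → G (k ∷ []) n (λ _ → 1ℚ) β ≡ rowSum n k 0
    G≡rowSum n k = begin
      G (k ∷ []) n (λ _ → 1ℚ) β
        ≡⟨ ∑-filter (isSVT (k ∷ [])) (allFillings n (k ∷ [])) weight ⟩
      ∑[ F ∈ allFillings n (k ∷ []) ] (if isSVT (k ∷ []) F then weight F else 0ℚ)
        ≡⟨ ∑-concatMap (λ v → (v , tt) ∷ []) (allVecs (allSubsets n) k) _ ⟩
      ∑[ v ∈ allVecs (allSubsets n) k ] ((if isSVT (k ∷ []) (v , tt) then weight (v , tt) else 0ℚ) + 0ℚ)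
        ≡⟨ ∑-cong (allVecs (allSubsets n) k) (λ v → trans (+-identityʳ _) (tableau-weight v)) ⟩
      rowSum n k 0 ∎
      where
      weight : Filling n (k ∷ []) → ℚ
      weight F = β ^ℚ (totalSize (k ∷ []) F ∸ size (k ∷ [])) * monomial (k ∷ []) (λ _ → 1ℚ) F
      tableau-weight : ∀ v → (if isSVT (k ∷ []) (v , tt) then weight (v , tt) else 0ℚ) ≡ rowWeight 0 v
      tableau-weight v rewrite rowWeight≡if-validFrom 0 v | validFrom0≡isSVT v | monomial-ones (k ∷ []) (v , tt)
                             | ℕ.+-identityʳ (Vec.sum (Vec.map card v)) | ℕ.+-identityʳ k
        with allNonempty v in ne | rowOK v
      ... | false | _     = refl
      ... | true  | false = refl
      ... | true  | true  rewrite sum-card≡k+excess v ne | ℕ.m+n∸m≡n k (excess v) = *-identityʳ (β ^ℚ excess v)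

    boxSum : ℕ → ℕ → (ℕ → ℚ) → ℚ
    boxSum n m φ = ∑[ A ∈ allSubsets n ] boxWeight m φ A

    ∑-boxWeight : ∀ {n} {C : Set} (xs : List C) m (φ : C → ℕ → ℚ) (A : Subset n) →
                  ∑[ x ∈ xs ] boxWeight m (φ x) A ≡ boxWeight m (λ m′ → ∑[ x ∈ xs ] φ x m′) A
    ∑-boxWeight xs m φ A with and (isNonempty A) (m ≤ᵇ minS A)
    ... | true  = ∑-*ˡ xs (β ^ℚ (card A ∸ 1)) (λ x → φ x (maxS A))
    ... | false = ∑-0 xs

    rowSum-zero : ∀ n m → rowSum n 0 m ≡ 1ℚ
    rowSum-zero n m = +-identityʳ 1ℚ

    rowSum-suc : ∀ n k m → rowSum n (suc k) m ≡ boxSum n m (rowSum n k)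
    rowSum-suc n k m = begin
      rowSum n (suc k) m
        ≡⟨ ∑-concatMap (λ A → List.map (A ∷_) rows) (allSubsets n) (rowWeight m) ⟩
      ∑[ A ∈ allSubsets n ] ∑ (List.map (A ∷_) rows) (rowWeight m)
        ≡⟨ ∑-cong (allSubsets n) (λ A → ∑-map (A ∷_) rows (rowWeight m)) ⟩
      ∑[ A ∈ allSubsets n ] ∑[ v ∈ rows ] boxWeight m (λ m′ → rowWeight m′ v) A
        ≡⟨ ∑-cong (allSubsets n) (∑-boxWeight rows m (λ v m′ → rowWeight m′ v)) ⟩
      boxSum n m (rowSum n k) ∎
      where
      rows : List (Vec (Subset n) k)
      rows = allVecs (allSubsets n) k

    boxWeight-1≡0 : ∀ φ {n} (A : Subset n) → boxWeight 1 φ A ≡ boxWeight 0 φ A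
    boxWeight-1≡0 φ []          = refl
    boxWeight-1≡0 φ (true  ∷ A) = refl
    boxWeight-1≡0 φ (false ∷ A) = refl

    rowSum-1≡0 : ∀ n k → rowSum n k 1 ≡ rowSum n k 0
    rowSum-1≡0 n k = ∑-cong (allVecs (allSubsets n) k) rowWeight-1≡0
      where
      rowWeight-1≡0 : ∀ {k} (v : Vec (Subset n) k) → rowWeight 1 v ≡ rowWeight 0 v
      rowWeight-1≡0 []      = refl
      rowWeight-1≡0 (A ∷ v) = boxWeight-1≡0 (λ m′ → rowWeight m′ v) A

    boxWeight-cong : ∀ m {φ ψ : ℕ → ℚ} → (∀ x → φ (suc x) ≡ ψ (suc x)) →
                     ∀ {n} (A : Subset n) → boxWeight m φ A ≡ boxWeight m ψ A
    boxWeight-cong m φ≗ψ A with isNonempty A in ne | m ≤ᵇ minS A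
    ... | false | _     = refl
    ... | true  | false = refl
    ... | true  | true  with maxS-nonempty A ne
    ...   | x , maxA≡1+x rewrite maxA≡1+x = cong (β ^ℚ (card A ∸ 1) *_) (φ≗ψ x)

    boxSum-cong : ∀ n m (φ ψ : ℕ → ℚ) → (∀ x → φ (suc x) ≡ ψ (suc x)) → boxSum n m φ ≡ boxSum n m ψ
    boxSum-cong n m φ ψ φ≗ψ = ∑-cong (allSubsets n) (boxWeight-cong m {φ} {ψ} φ≗ψ)

    boxSum-split : ∀ n m φ → boxSum (suc n) m φ ≡
      ∑[ A ∈ allSubsets n ] boxWeight m φ (outside ∷ A) + ∑[ A ∈ allSubsets n ] boxWeight m φ (inside ∷ A)
    boxSum-split n m φ =
      trans (∑-++ (List.map (outside ∷_) S) (List.map (inside ∷_) S) (boxWeight m φ))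
            (cong₂ _+_ (∑-map (outside ∷_) S (boxWeight m φ)) (∑-map (inside ∷_) S (boxWeight m φ)))
      where
      S : List (Subset n)
      S = allSubsets n

    boxWeight-outside : ∀ m φ {n} (A : Subset n) → boxWeight m φ (outside ∷ A) ≡ boxWeight (m ∸ 1) (λ x → φ (suc x)) A
    boxWeight-outside m φ A with isNonempty A
    ... | true  rewrite ≤ᵇ-suc m (minS A) = refl
    ... | false = refl

    boxWeight-inside : ∀ φ {n} (A : Subset n) →
      boxWeight 0 φ (inside ∷ A) ≡ (if isNonempty A then 0ℚ else φ 1) + β * boxWeight 0 (λ x → φ (suc x)) A
    boxWeight-inside φ A with isNonempty A in ne
    ... | true  rewrite card-nonempty A ne = begin
      β * β ^ℚ (card A ∸ 1) * φ (suc (maxS A))       ≡⟨ *-assoc β _ _ ⟩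
      β * (β ^ℚ (card A ∸ 1) * φ (suc (maxS A)))     ≡⟨ +-identityˡ _ ⟨
      0ℚ + β * (β ^ℚ (card A ∸ 1) * φ (suc (maxS A))) ∎
    ... | false rewrite card-empty A ne = begin
      1ℚ * φ 1        ≡⟨ *-identityˡ (φ 1) ⟩
      φ 1             ≡⟨ +-identityʳ (φ 1) ⟨
      φ 1 + 0ℚ        ≡⟨ cong (φ 1 +_) (*-zeroʳ β) ⟨
      φ 1 + β * 0ℚ    ∎

    boxSum-suc-0 : ∀ n φ → boxSum (suc n) 0 φ ≡
      boxSum n 0 (λ x → φ (suc x)) + (φ 1 + β * boxSum n 0 (λ x → φ (suc x)))
    boxSum-suc-0 n φ = begin
      boxSum (suc n) 0 φ
        ≡⟨ boxSum-split n 0 φ ⟩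
      ∑[ A ∈ S ] boxWeight 0 φ (outside ∷ A) + ∑[ A ∈ S ] boxWeight 0 φ (inside ∷ A)
        ≡⟨ cong₂ _+_ (∑-cong S (boxWeight-outside 0 φ)) (∑-cong S (boxWeight-inside φ)) ⟩
      boxSum n 0 φ⁺ + ∑[ A ∈ S ] ((if isNonempty A then 0ℚ else φ 1) + β * boxWeight 0 φ⁺ A)
        ≡⟨ cong (boxSum n 0 φ⁺ +_) (∑-+ S _ _) ⟩
      boxSum n 0 φ⁺ + (∑[ A ∈ S ] (if isNonempty A then 0ℚ else φ 1) + ∑[ A ∈ S ] (β * boxWeight 0 φ⁺ A))
        ≡⟨ cong (boxSum n 0 φ⁺ +_) (cong₂ _+_ (∑-empty n (φ 1)) (∑-*ˡ S β (boxWeight 0 φ⁺))) ⟩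
      boxSum n 0 φ⁺ + (φ 1 + β * boxSum n 0 φ⁺) ∎
      where
      S : List (Subset n)
      S = allSubsets n
      φ⁺ : ℕ → ℚ
      φ⁺ x = φ (suc x)

    boxSum-suc-≥2 : ∀ n b φ → boxSum (suc n) (suc (suc b)) φ ≡ boxSum n (suc b) (λ x → φ (suc x))
    boxSum-suc-≥2 n b φ = begin
      boxSum (suc n) (suc (suc b)) φ
        ≡⟨ boxSum-split n (suc (suc b)) φ ⟩
      ∑[ A ∈ S ] boxWeight (suc (suc b)) φ (outside ∷ A) + ∑[ A ∈ S ] 0ℚ
        ≡⟨ cong₂ _+_ (∑-cong S (boxWeight-outside (suc (suc b)) φ)) (∑-0 S) ⟩
      boxSum n (suc b) (λ x → φ (suc x)) + 0ℚ
        ≡⟨ +-identityʳ _ ⟩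
      boxSum n (suc b) (λ x → φ (suc x)) ∎
      where
      S : List (Subset n)
      S = allSubsets n

    -- A lower bound ≥ 2 excludes the letter 1, which can then be deleted from the alphabet.
    rowSum-shift : ∀ n k b → rowSum (suc n) k (suc (suc b)) ≡ rowSum n k (suc b)
    rowSum-shift n zero    b = trans (rowSum-zero (suc n) (suc (suc b))) (sym (rowSum-zero n (suc b)))
    rowSum-shift n (suc k) b = begin
      rowSum (suc n) (suc k) (suc (suc b))              ≡⟨ rowSum-suc (suc n) k (suc (suc b)) ⟩
      boxSum (suc n) (suc (suc b)) (rowSum (suc n) k)   ≡⟨ boxSum-suc-≥2 n b (rowSum (suc n) k) ⟩
      boxSum n (suc b) R⁺                               ≡⟨ boxSum-cong n (suc b) R⁺ (rowSum n k) (rowSum-shift n k) ⟩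
      boxSum n (suc b) (rowSum n k)                     ≡⟨ rowSum-suc n k (suc b) ⟨
      rowSum n (suc k) (suc b)                          ∎
      where
      R⁺ : ℕ → ℚ
      R⁺ x = rowSum (suc n) k (suc x)

    rowSum-rec : ∀ n k → rowSum (suc n) (suc k) 0 ≡
      rowSum n (suc k) 0 + (rowSum (suc n) k 0 + β * rowSum n (suc k) 0)
    rowSum-rec n k = begin
      rowSum (suc n) (suc k) 0
        ≡⟨ rowSum-suc (suc n) k 0 ⟩
      boxSum (suc n) 0 (rowSum (suc n) k)
        ≡⟨ boxSum-suc-0 n (rowSum (suc n) k) ⟩
      boxSum n 0 R⁺ + (rowSum (suc n) k 1 + β * boxSum n 0 R⁺)
        ≡⟨ cong₂ (λ x y → x + (y + β * x)) first-unused (rowSum-1≡0 (suc n) k) ⟩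
      rowSum n (suc k) 0 + (rowSum (suc n) k 0 + β * rowSum n (suc k) 0) ∎
      where
      R⁺ : ℕ → ℚ
      R⁺ x = rowSum (suc n) k (suc x)
      first-unused : boxSum n 0 R⁺ ≡ rowSum n (suc k) 0
      first-unused = trans (boxSum-cong n 0 R⁺ (rowSum n k) (rowSum-shift n k)) (sym (rowSum-suc n k 0))

    rowSum-empty-alphabet : ∀ k → rowSum 0 (suc k) 0 ≡ 0ℚ
    rowSum-empty-alphabet k = trans (rowSum-suc 0 k 0) (+-identityʳ 0ℚ)

  -- The number of row tableaux of length k over [n] with k + m entries.
  coeff : ℕ → ℕ → ℕ → ℕ
  coeff n k m = ((n ℕ.+ k ∸ 1) C (k ℕ.+ m)) ℕ.* ((k ℕ.+ m ∸ 1) C m)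

  coeff-pascal-0 : ∀ n k → coeff (suc n) (suc k) 0 ≡ coeff n (suc k) 0 ℕ.+ coeff (suc n) k 0
  coeff-pascal-0 n k rewrite ℕ.+-suc n k | ℕ.+-identityʳ k | [n+1]C[k+1]≡nCk+nC[k+1] (n ℕ.+ k) k =
    solve 2 (λ x y → (x :+ y) :* con 1 := y :* con 1 :+ x :* con 1) refl ((n ℕ.+ k) C k) ((n ℕ.+ k) C suc k)
    where open NatSolver

  coeff-pascal : ∀ n k m → coeff (suc n) (suc k) (suc m) ≡
    coeff n (suc k) (suc m) ℕ.+ (coeff (suc n) k (suc m) ℕ.+ coeff n (suc k) m)
  coeff-pascal n k m rewrite ℕ.+-suc n k | ℕ.+-suc k m
    | [n+1]C[k+1]≡nCk+nC[k+1] (n ℕ.+ k) (suc (k ℕ.+ m)) | [n+1]C[k+1]≡nCk+nC[k+1] (k ℕ.+ m) m =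
    solve 4 (λ a b u v → (b :+ a) :* (u :+ v) := a :* (u :+ v) :+ (b :* v :+ b :* u)) refl
      ((n ℕ.+ k) C suc (suc (k ℕ.+ m))) ((n ℕ.+ k) C suc (k ℕ.+ m)) ((k ℕ.+ m) C m) ((k ℕ.+ m) C suc m)
    where open NatSolver

  coeff-≥ : ∀ {n m} k → n ≤ m → coeff n (suc k) m ≡ 0
  coeff-≥ {n} {m} k n≤m = cong (ℕ._* ((suc k ℕ.+ m ∸ 1) C m)) (k>n⇒nCk≡0 (s≤s
    (ℕ.≤-trans (ℕ.≤-reflexive (cong (_∸ 1) (ℕ.+-suc n k)))
      (ℕ.≤-trans (ℕ.+-monoˡ-≤ k n≤m) (ℕ.≤-reflexive (ℕ.+-comm m k))))))

  coeff-empty-row : ∀ n m → coeff n 0 (suc m) ≡ 0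
  coeff-empty-row n m = trans (cong (x ℕ.*_) (k>n⇒nCk≡0 (ℕ.n<1+n m))) (ℕ.*-zeroʳ x)
    where
    x : ℕ
    x = (n ℕ.+ 0 ∸ 1) C suc m

  coeff-empty-alphabet : ∀ k → coeff 0 (suc k) 0 ≡ 0
  coeff-empty-alphabet k = cong (ℕ._* 1) (k>n⇒nCk≡0 (s≤s (ℕ.m≤m+n k 0)))

  coeff-ratio : ∀ d e m →
    coeff (suc d) (suc e) (suc m) ℕ.* (suc (suc (e ℕ.+ m)) ℕ.* suc m)
      ≡ coeff (suc d) (suc e) m ℕ.* (suc (e ℕ.+ m) ℕ.* (d ∸ m))
  coeff-ratio d e m rewrite ℕ.+-suc e m = begin
    (N C suc (suc j)) ℕ.* (suc j C suc m) ℕ.* (suc (suc j) ℕ.* suc m)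
      ≡⟨ solve 4 (λ x y a b → x :* y :* (a :* b) := (x :* a) :* (y :* b)) refl
           (N C suc (suc j)) (suc j C suc m) (suc (suc j)) (suc m) ⟩
    ((N C suc (suc j)) ℕ.* suc (suc j)) ℕ.* ((suc j C suc m) ℕ.* suc m)
      ≡⟨ cong₂ ℕ._*_ (nC[k+1]*[k+1]≡nCk*[n∸k] N (suc j)) ([n+1]C[k+1]*[k+1]≡nCk*[n+1] j m) ⟩
    ((N C suc j) ℕ.* (N ∸ suc j)) ℕ.* ((j C m) ℕ.* suc j)
      ≡⟨ cong (λ x → ((N C suc j) ℕ.* x) ℕ.* ((j C m) ℕ.* suc j)) N∸[1+j]≡d∸m ⟩
    ((N C suc j) ℕ.* (d ∸ m)) ℕ.* ((j C m) ℕ.* suc j)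
      ≡⟨ solve 4 (λ x y a b → (x :* a) :* (y :* b) := x :* y :* (b :* a)) refl (N C suc j) (j C m) (d ∸ m) (suc j) ⟩
    (N C suc j) ℕ.* (j C m) ℕ.* (suc j ℕ.* (d ∸ m)) ∎
    where
    open NatSolver
    N j : ℕ
    N = d ℕ.+ suc e
    j = e ℕ.+ m
    N∸[1+j]≡d∸m : N ∸ suc j ≡ d ∸ m
    N∸[1+j]≡d∸m = trans (cong (_∸ suc j) (ℕ.+-comm d (suc e))) (ℕ.[m+n]∸[m+o]≡n∸o (suc e) d m)

  coeff-hypergeometric : ∀ d e m →
    ((d ℕ.+ suc e) C suc e) ℕ.* rising (suc e) m ℕ.* (d P′ m)
      ≡ coeff (suc d) (suc e) m ℕ.* rising (suc (suc e)) m ℕ.* (m !)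
  coeff-hypergeometric d e zero    rewrite ℕ.+-identityʳ e = sym (ℕ.*-identityʳ (((d ℕ.+ suc e) C suc e) ℕ.* 1 ℕ.* 1))
  coeff-hypergeometric d e (suc m) = begin
    C₀ ℕ.* (rising (suc e) m ℕ.* suc j) ℕ.* ((d ∸ m) ℕ.* (d P′ m))
      ≡⟨ solve 5 (λ c r s t f → c :* (r :* s) :* (t :* f) := c :* r :* f :* (s :* t)) refl
           C₀ (rising (suc e) m) (suc j) (d ∸ m) (d P′ m) ⟩
    C₀ ℕ.* rising (suc e) m ℕ.* (d P′ m) ℕ.* (suc j ℕ.* (d ∸ m))
      ≡⟨ cong (ℕ._* (suc j ℕ.* (d ∸ m))) (coeff-hypergeometric d e m) ⟩
    coeff (suc d) (suc e) m ℕ.* R ℕ.* (m !) ℕ.* (suc j ℕ.* (d ∸ m))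
      ≡⟨ solve 4 (λ c r f s → c :* r :* f :* s := c :* s :* r :* f) refl
           (coeff (suc d) (suc e) m) R (m !) (suc j ℕ.* (d ∸ m)) ⟩
    coeff (suc d) (suc e) m ℕ.* (suc j ℕ.* (d ∸ m)) ℕ.* R ℕ.* (m !)
      ≡⟨ cong (λ x → x ℕ.* R ℕ.* (m !)) (coeff-ratio d e m) ⟨
    coeff (suc d) (suc e) (suc m) ℕ.* (suc (suc j) ℕ.* suc m) ℕ.* R ℕ.* (m !)
      ≡⟨ solve 5 (λ c a b r f → c :* (a :* b) :* r :* f := c :* (r :* a) :* (b :* f)) refl
           (coeff (suc d) (suc e) (suc m)) (suc (suc j)) (suc m) R (m !) ⟩
    coeff (suc d) (suc e) (suc m) ℕ.* (R ℕ.* suc (suc j)) ℕ.* (suc m ℕ.* (m !)) ∎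
    where
    open NatSolver
    C₀ j R : ℕ
    C₀ = (d ℕ.+ suc e) C suc e
    j = e ℕ.+ m
    R = rising (suc (suc e)) m

  module ClosedForm (β : ℚ) where

    term : ℕ → ℕ → ℕ → ℚ
    term n k m = ℕtoℚ (coeff n k m) * β ^ℚ m

    closedForm : ℕ → ℕ → ℚ
    closedForm n k = sumTo n (term n k)

    closedForm-empty-row : ∀ n → closedForm n 0 ≡ 1ℚ
    closedForm-empty-row n = sumTo-concentrated n (term n 0) (λ m → c≡0⇒ℕtoℚ[c]*x≡0 (coeff-empty-row n m) (β ^ℚ suc m))

    closedForm-empty-alphabet : ∀ k → closedForm 0 (suc k) ≡ 0ℚ
    closedForm-empty-alphabet k = c≡0⇒ℕtoℚ[c]*x≡0 (coeff-empty-alphabet k) 1ℚ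

    sumTo-term-drop-last : ∀ {n} N k → n ≤ suc N → sumTo (suc N) (term n (suc k)) ≡ sumTo N (term n (suc k))
    sumTo-term-drop-last N k n≤1+N =
      trans (cong (sumTo N _ +_) (c≡0⇒ℕtoℚ[c]*x≡0 (coeff-≥ k n≤1+N) (β ^ℚ suc N))) (+-identityʳ _)

    closedForm-rec : ∀ n k → closedForm (suc n) (suc k) ≡
      closedForm n (suc k) + (closedForm (suc n) k + β * closedForm n (suc k))
    closedForm-rec n k = sym (begin
      sumTo n t₁ + (sumTo (suc n) t₂ + β * sumTo n t₁)
        ≡⟨ cong₂ (λ x y → x + (sumTo (suc n) t₂ + y)) extend (sym shifted) ⟩
      sumTo (suc n) t₁ + (sumTo (suc n) t₂ + sumTo (suc n) t₃)
        ≡⟨ cong (sumTo (suc n) t₁ +_) (sumTo-+ (suc n) t₂ t₃) ⟨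
      sumTo (suc n) t₁ + sumTo (suc n) (λ m → t₂ m + t₃ m)
        ≡⟨ sumTo-+ (suc n) t₁ _ ⟨
      sumTo (suc n) (λ m → t₁ m + (t₂ m + t₃ m))
        ≡⟨ sumTo-cong (suc n) (λ m _ → pascal m) ⟩
      closedForm (suc n) (suc k) ∎)
      where
      t₁ t₂ t₃ : ℕ → ℚ
      t₁ = term n (suc k)
      t₂ = term (suc n) k
      t₃ zero    = 0ℚ
      t₃ (suc m) = β * t₁ m
      extend : sumTo n t₁ ≡ sumTo (suc n) t₁
      extend = sym (sumTo-term-drop-last n k (ℕ.n≤1+n n))
      shifted : sumTo (suc n) t₃ ≡ β * sumTo n t₁
      shifted = trans (sumTo-suc n t₃) (trans (+-identityˡ _) (sumTo-*ˡ n β t₁))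
      pascal : ∀ m → t₁ m + (t₂ m + t₃ m) ≡ term (suc n) (suc k) m
      pascal zero    = begin
        t₁ 0 + (t₂ 0 + 0ℚ)                                     ≡⟨ cong (t₁ 0 +_) (+-identityʳ (t₂ 0)) ⟩
        t₁ 0 + t₂ 0                                            ≡⟨ ℕtoℚ-+-* (coeff n (suc k) 0) (coeff (suc n) k 0) 1ℚ ⟩
        ℕtoℚ (coeff n (suc k) 0 ℕ.+ coeff (suc n) k 0) * 1ℚ    ≡⟨ cong (λ c → ℕtoℚ c * 1ℚ) (coeff-pascal-0 n k) ⟨
        term (suc n) (suc k) 0                                 ∎
      pascal (suc m) = begin
        t₁ (suc m) + (t₂ (suc m) + β * (ℕtoℚ c * β ^ℚ m))
          ≡⟨ cong (λ x → t₁ (suc m) + (t₂ (suc m) + x)) (ℚ*.x∙yz≈y∙xz β (ℕtoℚ c) (β ^ℚ m)) ⟩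
        t₁ (suc m) + (ℕtoℚ b * β ^ℚ suc m + ℕtoℚ c * β ^ℚ suc m)
          ≡⟨ cong (t₁ (suc m) +_) (ℕtoℚ-+-* b c (β ^ℚ suc m)) ⟩
        ℕtoℚ a * β ^ℚ suc m + ℕtoℚ (b ℕ.+ c) * β ^ℚ suc m
          ≡⟨ ℕtoℚ-+-* a (b ℕ.+ c) (β ^ℚ suc m) ⟩
        ℕtoℚ (a ℕ.+ (b ℕ.+ c)) * β ^ℚ suc m
          ≡⟨ cong (λ x → ℕtoℚ x * β ^ℚ suc m) (coeff-pascal n k m) ⟨
        term (suc n) (suc k) (suc m) ∎
        where
        a b c : ℕ
        a = coeff n (suc k) (suc m)
        b = coeff (suc n) k (suc m)
        c = coeff n (suc k) m

    hypergeometric-term : ∀ d e m → m ≤ d →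
      ℕtoℚ ((d ℕ.+ suc e) C suc e) * ₂F₁-summand (ℕtoℚ (suc e)) (- ℕtoℚ d) (ℕtoℚ (suc (suc e))) (- β) m
      ≡ term (suc d) (suc e) m
    hypergeometric-term d e m m≤d = begin
      ℕtoℚ C₀ * ₂F₁-summand (ℕtoℚ (suc e)) (- ℕtoℚ d) (ℕtoℚ (suc (suc e))) (- β) m
        ≡⟨ cong (ℕtoℚ C₀ *_) (cong₂ _*_
             (cong₂ _divℚ_ (cong₂ _*_ (poch-ℕtoℚ (suc e) m) (poch-neg d m m≤d)) (poch-ℕtoℚ (suc (suc e)) m))
             (cong₂ _divℚ_ (neg-^ℚ β m) (factℚ-ℕtoℚ m))) ⟩
      ℕtoℚ C₀ * (((ℕtoℚ R * (S * ℕtoℚ F)) divℚ ℕtoℚ R′) * ((S * βᵐ) divℚ ℕtoℚ (m !)))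
        ≡⟨ divℚ-cross-multiply (ℕtoℚ C₀) (ℕtoℚ R * (S * ℕtoℚ F)) (ℕtoℚ R′) (S * βᵐ) (ℕtoℚ (m !)) _
             (ℕtoℚ-≢0 R′ {{rising-nonZero (suc e) m}}) (ℕtoℚ-≢0 (m !) {{m ℕ.!≢0}}) denominators-cleared ⟩
      term (suc d) (suc e) m ∎
      where
      open +-*-Solver
      C₀ c R R′ F : ℕ
      C₀ = (d ℕ.+ suc e) C suc e
      c  = coeff (suc d) (suc e) m
      R  = rising (suc e) m
      R′ = rising (suc (suc e)) m
      F  = d P′ m
      S βᵐ : ℚ
      S  = sign m
      βᵐ = β ^ℚ m
      denominators-cleared : ℕtoℚ C₀ * (ℕtoℚ R * (S * ℕtoℚ F)) * (S * βᵐ) ≡ ℕtoℚ c * βᵐ * ℕtoℚ R′ * ℕtoℚ (m !)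
      denominators-cleared = begin
        ℕtoℚ C₀ * (ℕtoℚ R * (S * ℕtoℚ F)) * (S * βᵐ)
          ≡⟨ solve 5 (λ c r s f b → c :* (r :* (s :* f)) :* (s :* b) := c :* r :* f :* b :* (s :* s)) refl
               (ℕtoℚ C₀) (ℕtoℚ R) S (ℕtoℚ F) βᵐ ⟩
        ℕtoℚ C₀ * ℕtoℚ R * ℕtoℚ F * βᵐ * (S * S)
          ≡⟨ cong₂ (λ p s → p * βᵐ * s) (ℕtoℚ-*³ C₀ R F) (sym (sign-square m)) ⟨
        ℕtoℚ (C₀ ℕ.* R ℕ.* F) * βᵐ * 1ℚ
          ≡⟨ cong (λ x → ℕtoℚ x * βᵐ * 1ℚ) (coeff-hypergeometric d e m) ⟩
        ℕtoℚ (c ℕ.* R′ ℕ.* (m !)) * βᵐ * 1ℚ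
          ≡⟨ cong (λ p → p * βᵐ * 1ℚ) (ℕtoℚ-*³ c R′ (m !)) ⟩
        ℕtoℚ c * ℕtoℚ R′ * ℕtoℚ (m !) * βᵐ * 1ℚ
          ≡⟨ solve 4 (λ c r f b → c :* r :* f :* b :* con 1ℚ := c :* b :* r :* f) refl
               (ℕtoℚ c) (ℕtoℚ R′) (ℕtoℚ (m !)) βᵐ ⟩
        ℕtoℚ c * βᵐ * ℕtoℚ R′ * ℕtoℚ (m !) ∎

  module _ (β : ℚ) where
    open RowSums β
    open ClosedForm β

    rowSum≡closedForm : ∀ n k → rowSum n k 0 ≡ closedForm n k
    rowSum≡closedForm n       zero    = trans (rowSum-zero n 0) (sym (closedForm-empty-row n))
    rowSum≡closedForm zero    (suc k) = trans (rowSum-empty-alphabet k) (sym (closedForm-empty-alphabet k))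
    rowSum≡closedForm (suc n) (suc k) = begin
      rowSum (suc n) (suc k) 0
        ≡⟨ rowSum-rec n k ⟩
      rowSum n (suc k) 0 + (rowSum (suc n) k 0 + β * rowSum n (suc k) 0)
        ≡⟨ cong₂ (λ x y → x + (y + β * x)) (rowSum≡closedForm n (suc k)) (rowSum≡closedForm (suc n) k) ⟩
      closedForm n (suc k) + (closedForm (suc n) k + β * closedForm n (suc k))
        ≡⟨ closedForm-rec n k ⟨
      closedForm (suc n) (suc k) ∎

open import Data.Nat using (ℕ; suc; _+_; _∸_; _≤_)
open import Data.Nat.Combinatorics using (_C_)
open import Data.List using (_∷_; [])
open import Data.Rational using (ℚ; 1ℚ; _*_; -_)
open import Relation.Binary.PropositionalEquality using (_≡_)
open import Data.Nat.Properties using (≤-refl)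
open import Relation.Binary.PropositionalEquality using (sym; module ≡-Reasoning)
open ≡-Reasoning

proposition3p1 : (n k : ℕ) → 1 ≤ n → 1 ≤ k → (β : ℚ) →
    G (k ∷ []) n (λ _ → 1ℚ) β
      ≡ ℕtoℚ ((n + k ∸ 1) C k) * ₂F₁-term (ℕtoℚ k) (n ∸ 1) (ℕtoℚ (suc k)) (- β)
proposition3p1 (suc d) (suc e) _ _ β = begin
  G (suc e ∷ []) (suc d) (λ _ → 1ℚ) β
    ≡⟨ G≡rowSum (suc d) (suc e) ⟩
  rowSum (suc d) (suc e) 0
    ≡⟨ rowSum≡closedForm β (suc d) (suc e) ⟩
  sumTo (suc d) (term (suc d) (suc e))
    ≡⟨ sumTo-term-drop-last d e ≤-refl ⟩
  sumTo d (term (suc d) (suc e))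
    ≡⟨ sumTo-cong d (λ m m≤d → sym (hypergeometric-term d e m m≤d)) ⟩
  sumTo d (λ m → ℕtoℚ C₀ * ₂F₁-summand (ℕtoℚ (suc e)) (- ℕtoℚ d) (ℕtoℚ (suc (suc e))) (- β) m)
    ≡⟨ sumTo-*ˡ d (ℕtoℚ C₀) (₂F₁-summand (ℕtoℚ (suc e)) (- ℕtoℚ d) (ℕtoℚ (suc (suc e))) (- β)) ⟩
  ℕtoℚ C₀ * ₂F₁-term (ℕtoℚ (suc e)) d (ℕtoℚ (suc (suc e))) (- β) ∎
  where
  open RowSums β
  open ClosedForm β
  C₀ : ℕ
  C₀ = (d + suc e) C suc e
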